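{- Let $p>q\geq 1$ be integers and let $u_\beta$ be the fixed point of the substitution $\varphi: A\mapsto A^pB,\ B\mapsto A^qB$. Then $u_\beta$ is $\lceil p/q\rceil$-balanced. Moreover, any prefix of $u_\beta$ contains at least as many letters $A$ as any other factor of $u_\beta$ of the same length.
   Context: An infinite word $u$ over $\{A,B\}$ is $c$-balanced if for every pair of finite factors $w,\hat w$ of $u$ with $|w|=|\hat w|$ one has $\bigl||w|_A-|\hat w|_A\bigr|\le c$, where $|w|_A$ is the number of occurrences of $A$ in $w$. $u_\beta=\lim_n\varphi^n(A)$; equivalently, for $\beta$ the larger root of $x^2-(p+1)x+(p-q)$, $u_\beta$ is the word obtained by writing $A$ for each gap of length $1$ and $B$ for each gap of length $1-\frac{p-q}{\beta}$ between consecutive nonnegative $\beta$-integers, read from $0$ upward. -}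

module Defs where

open import Data.Nat using (ℕ; zero; suc; _+_; _≤_)
open import Data.Nat.DivMod using (_/_)
open import Data.List using (List; []; _∷_; _++_; replicate; concatMap)

data Letter : Set where
  A B : Letter

Word : Set
Word = List Letter

φ : ℕ → ℕ → Letter → Word
φ p q A = replicate p A ++ (B ∷ [])
φ p q B = replicate q A ++ (B ∷ [])

φ* : ℕ → ℕ → Word → Word
φ* p q = concatMap (φ p q)

iter : ℕ → ℕ → ℕ → Word
iter p q zero    = A ∷ []
iter p q (suc k) = φ* p q (iter p q k)

-- n-th letter of a finite word (default B if out of range; never used
-- out of range for the fixed point below)
at : Word → ℕ → Letter
at []      n       = B
at (x ∷ w) zero    = x
at (x ∷ w) (suc n) = at w n

-- u_β = lim φ^n(A) (for q ≥ 1, |φ^k(A)| ≥ 2^k > n at k = n+1, and φ^k(A)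
-- is a prefix of φ^(k+1)(A) since p ≥ 1); u p q n is the n-th letter (0-based).
u : ℕ → ℕ → ℕ → Letter
u p q n = at (iter p q (suc n)) n

isA : Letter → ℕ
isA A = 1
isA B = 0

countA : (ℕ → Letter) → ℕ → ℕ → ℕ
countA x i zero    = 0
countA x i (suc m) = isA (x i) + countA x (suc i) m

Balanced : ℕ → (ℕ → Letter) → Set
Balanced c x = ∀ i j m → countA x i m ≤ countA x j m + c

ceilDiv : ℕ → ℕ → ℕ
ceilDiv p zero    = 0
ceilDiv p (suc k) = (p + k) / suc k

-- Write P k (blockStart below) for the position at which the block φ(u_k) of
-- u = φ(u) starts and N n for the number of B's among the first n letters of u.
-- Every block ends with its only B, so N (P k) = k and P k ≤ n ⇔ k ≤ N n; the
-- blocks φ(A), φ(B) have lengths p + 1 and q + 1, so P k + (p − q) N k =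
-- (p + 1) k. Both claims are inequalities for N: N j + N m ≤ N (j + m)
-- (prefixes have the fewest B's) and N (j + m) ≤ N j + N m + ⌈p/q⌉. Each is
-- proved by strong induction: the Galois connection turns an inequality for N
-- around position n into one for P around position N n < n, and the linear
-- identity turns that back into an inequality for N.

module Submission where

open import Defs
open import Data.Nat using (ℕ; _≤_; _<_)
open import Data.Product using (_×_)

open import Data.Empty using (⊥-elim)
open import Data.List using ([]; _∷_; _++_; length; replicate; concatMap)
open import Data.List.Properties using (length-++; ++-assoc; ++-identityʳ; concatMap-++)
open import Data.Nat
  using (zero; suc; _+_; _*_; _∸_; _⊔_; z≤n; s≤s; _≤?_; _<?_; _≤′_; ≤′-refl; ≤′-step)
open import Data.Nat.DivMod using (_/_; _%_; m≡m%n+[m/n]*n; m%n<n)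
open import Data.Nat.Induction using (<-rec)
open import Data.Nat.Properties
open import Data.Nat.Tactic.RingSolver using (solve-∀)
open import Data.Product using (∃; _,_)
open import Relation.Binary.PropositionalEquality
open import Relation.Nullary using (yes; no)

≤-*-ceilDiv : ∀ p q → 1 ≤ q → p ≤ q * ceilDiv p q
≤-*-ceilDiv p (suc k) _ = +-cancelʳ-≤ k p (suc k * Q) (begin
  p + k                        ≡⟨ m≡m%n+[m/n]*n (p + k) (suc k) ⟩
  (p + k) % suc k + Q * suc k  ≤⟨ +-monoˡ-≤ (Q * suc k) (≤-pred (m%n<n (p + k) (suc k))) ⟩
  k + Q * suc k                ≡⟨ +-comm k (Q * suc k) ⟩
  Q * suc k + k                ≡⟨ cong (_+ k) (*-comm Q (suc k)) ⟩
  suc k * Q + k                ∎)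
  where
  open ≤-Reasoning
  Q = (p + k) / suc k

-- Counting letters in an infinite word

isB : Letter → ℕ
isB A = 0
isB B = 1

isA+isB≡1 : ∀ l → isA l + isB l ≡ 1
isA+isB≡1 A = refl
isA+isB≡1 B = refl

isB≤1 : ∀ l → isB l ≤ 1
isB≤1 A = z≤n
isB≤1 B = s≤s z≤n

#B : (ℕ → Letter) → ℕ → ℕ
#B x zero    = 0
#B x (suc n) = #B x n + isB (x n)

#B-mono : ∀ x {m n} → m ≤ n → #B x m ≤ #B x n
#B-mono x m≤n = mono′ (≤⇒≤′ m≤n)
  where
  mono′ : ∀ {m n} → m ≤′ n → #B x m ≤ #B x n
  mono′ ≤′-refl     = ≤-refl
  mono′ (≤′-step h) = ≤-trans (mono′ h) (m≤m+n _ _)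

#B-+-≤ : ∀ x j y → #B x (j + y) ≤ #B x j + y
#B-+-≤ x j zero    = ≤-reflexive (trans (cong (#B x) (+-identityʳ j)) (sym (+-identityʳ _)))
#B-+-≤ x j (suc y) = begin
  #B x (j + suc y)                ≡⟨ cong (#B x) (+-suc j y) ⟩
  #B x (j + y) + isB (x (j + y))  ≤⟨ +-mono-≤ (#B-+-≤ x j y) (isB≤1 (x (j + y))) ⟩
  #B x j + y + 1                  ≡⟨ trans (+-assoc (#B x j) y 1) (cong (#B x j +_) (+-comm y 1)) ⟩
  #B x j + suc y                  ∎
  where open ≤-Reasoning

countA+#B : ∀ x j m → countA x j m + #B x (j + m) ≡ m + #B x j
countA+#B x j zero    = cong (#B x) (+-identityʳ j)
countA+#B x j (suc m) = begin
  isA l + countA x (suc j) m + #B x (j + suc m)    ≡⟨ cong (λ n → isA l + countA x (suc j) m + #B x n) (+-suc j m) ⟩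
  isA l + countA x (suc j) m + #B x (suc j + m)    ≡⟨ +-assoc (isA l) _ _ ⟩
  isA l + (countA x (suc j) m + #B x (suc j + m))  ≡⟨ cong (isA l +_) (countA+#B x (suc j) m) ⟩
  isA l + (m + (#B x j + isB l))                   ≡⟨ regroup (isA l) m (#B x j) (isB l) ⟩
  (isA l + isB l) + (m + #B x j)                   ≡⟨ cong (_+ (m + #B x j)) (isA+isB≡1 l) ⟩
  suc m + #B x j                                   ∎
  where
  open ≡-Reasoning
  l = x j
  regroup : ∀ a m n b → a + (m + (n + b)) ≡ (a + b) + (m + n)
  regroup = solve-∀

countA-prefix : ∀ x m → countA x 0 m + #B x m ≡ m
countA-prefix x m = trans (countA+#B x 0 m) (+-identityʳ m)

prefixes-maximise-A : ∀ x → (∀ j m → #B x j + #B x m ≤ #B x (j + m)) →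
  ∀ j m → countA x j m ≤ countA x 0 m
prefixes-maximise-A x superadditive j m = +-cancelʳ-≤ (#B x (j + m)) _ _ (begin
  countA x j m + #B x (j + m)       ≡⟨ countA+#B x j m ⟩
  m + #B x j                        ≡⟨ cong (_+ #B x j) (countA-prefix x m) ⟨
  countA x 0 m + #B x m + #B x j    ≡⟨ +-assoc (countA x 0 m) _ _ ⟩
  countA x 0 m + (#B x m + #B x j)  ≤⟨ +-monoʳ-≤ (countA x 0 m) Bm+Bj≤ ⟩
  countA x 0 m + #B x (j + m)       ∎)
  where
  open ≤-Reasoning
  Bm+Bj≤ : #B x m + #B x j ≤ #B x (j + m)
  Bm+Bj≤ = subst (_≤ #B x (j + m)) (+-comm (#B x j) (#B x m)) (superadditive j m)

balanced-if : ∀ x c → (∀ j m → countA x j m ≤ countA x 0 m) →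
  (∀ j m → #B x (j + m) ≤ #B x j + (#B x m + c)) → Balanced c x
balanced-if x c prefixMaximal subadditive i j m = ≤-trans (prefixMaximal i m) prefix≤
  where
  open ≤-Reasoning
  regroup₁ : ∀ a b e → a + (b + e) ≡ a + e + b
  regroup₁ = solve-∀
  regroup₂ : ∀ a b e c → a + (b + (e + c)) ≡ a + c + (b + e)
  regroup₂ = solve-∀
  prefix≤ : countA x 0 m ≤ countA x j m + c
  prefix≤ = +-cancelʳ-≤ (#B x j + #B x m) _ _ (begin
    countA x 0 m + (#B x j + #B x m)        ≡⟨ regroup₁ (countA x 0 m) (#B x j) (#B x m) ⟩
    countA x 0 m + #B x m + #B x j          ≡⟨ cong (_+ #B x j) (countA-prefix x m) ⟩
    m + #B x j                              ≡⟨ countA+#B x j m ⟨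
    countA x j m + #B x (j + m)             ≤⟨ +-monoʳ-≤ (countA x j m) (subadditive j m) ⟩
    countA x j m + (#B x j + (#B x m + c))  ≡⟨ regroup₂ (countA x j m) (#B x j) (#B x m) c ⟩
    countA x j m + c + (#B x j + #B x m)    ∎)

-- Prefixes of finite and infinite words

infix 4 _⊑_

_⊑_ : Word → Word → Set
xs ⊑ ys = ∃ λ s → ys ≡ xs ++ s

⊑-refl : ∀ xs → xs ⊑ xs
⊑-refl xs = [] , sym (++-identityʳ xs)

⊑-trans : ∀ {xs ys zs} → xs ⊑ ys → ys ⊑ zs → xs ⊑ zs
⊑-trans {xs} (s , refl) (s′ , refl) = s ++ s′ , ++-assoc xs s s′

concatMap-⊑ : ∀ (σ : Letter → Word) {xs ys} → xs ⊑ ys → concatMap σ xs ⊑ concatMap σ ys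
concatMap-⊑ σ {xs} (s , refl) = concatMap σ s , concatMap-++ σ xs s

at-++ˡ : ∀ xs ys {n} → n < length xs → at (xs ++ ys) n ≡ at xs n
at-++ˡ (x ∷ xs) ys {zero}  _       = refl
at-++ˡ (x ∷ xs) ys {suc n} (s≤s h) = at-++ˡ xs ys h

at-++ʳ : ∀ xs ys n → at (xs ++ ys) (length xs + n) ≡ at ys n
at-++ʳ []       ys n = refl
at-++ʳ (x ∷ xs) ys n = at-++ʳ xs ys n

at-⊑ : ∀ {xs ys n} → xs ⊑ ys → n < length xs → at ys n ≡ at xs n
at-⊑ {xs} (s , refl) = at-++ˡ xs s

prefix : (ℕ → Letter) → ℕ → Word
prefix x zero    = []
prefix x (suc n) = prefix x n ++ x n ∷ []

length-prefix : ∀ x n → length (prefix x n) ≡ n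
length-prefix x zero    = refl
length-prefix x (suc n) =
  trans (length-++ (prefix x n)) (trans (cong (_+ 1) (length-prefix x n)) (+-comm n 1))

prefix-⊑ : ∀ x ys → (∀ {i} → i < length ys → at ys i ≡ x i) →
  ∀ n → n ≤ length ys → prefix x n ⊑ ys
prefix-⊑ x ys agree zero    _     = ys , refl
prefix-⊑ x ys agree (suc n) n<len with prefix-⊑ x ys agree n (<⇒≤ n<len)
... | [] , eq = ⊥-elim (<⇒≱ n<len (≤-reflexive len≡n))
  where
  len≡n : length ys ≡ n
  len≡n = trans (cong length eq)
    (trans (length-++ (prefix x n)) (trans (+-identityʳ _) (length-prefix x n)))
... | l ∷ s , eq = s , (begin
  ys                     ≡⟨ eq ⟩
  prefix x n ++ l ∷ s    ≡⟨ cong (λ l′ → prefix x n ++ l′ ∷ s) l≡xn ⟩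
  prefix x n ++ x n ∷ s  ≡⟨ ++-assoc (prefix x n) (x n ∷ []) s ⟨
  prefix x (suc n) ++ s  ∎)
  where
  open ≡-Reasoning
  l≡xn : l ≡ x n
  l≡xn = begin
    l                                                   ≡⟨ at-++ʳ (prefix x n) (l ∷ s) 0 ⟨
    at (prefix x n ++ l ∷ s) (length (prefix x n) + 0)  ≡⟨ cong (at (prefix x n ++ l ∷ s)) (trans (+-identityʳ _) (length-prefix x n)) ⟩
    at (prefix x n ++ l ∷ s) n                          ≡⟨ cong (λ w → at w n) eq ⟨
    at ys n                                             ≡⟨ agree n<len ⟩
    x n                                                 ∎

length-Aⁿ-B : ∀ n → length (replicate n A ++ B ∷ []) ≡ suc n
length-Aⁿ-B zero    = refl
length-Aⁿ-B (suc n) = cong suc (length-Aⁿ-B n)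

at-Aⁿ-B-< : ∀ n {t} → t < n → at (replicate n A ++ B ∷ []) t ≡ A
at-Aⁿ-B-< (suc n) {zero}  _       = refl
at-Aⁿ-B-< (suc n) {suc t} (s≤s h) = at-Aⁿ-B-< n h

at-Aⁿ-B-n : ∀ n → at (replicate n A ++ B ∷ []) n ≡ B
at-Aⁿ-B-n zero    = refl
at-Aⁿ-B-n (suc n) = at-Aⁿ-B-n n

A-⊑-Aⁿ-B : ∀ n → 1 ≤ n → A ∷ [] ⊑ (replicate n A ++ B ∷ []) ++ []
A-⊑-Aⁿ-B (suc n) _ = (replicate n A ++ B ∷ []) ++ [] , refl

-- Two counting functions tied by a linear identity

module WeightedCount (P N : ℕ → ℕ) (d s : ℕ) (weight : ∀ k → P k + d * N k ≡ s * k) where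

  N-superadd⇒P-subadd : ∀ x y → N x + N y ≤ N (x + y) → P (x + y) ≤ P x + P y
  N-superadd⇒P-subadd x y h = +-cancelʳ-≤ (d * N (x + y)) _ _ (begin
    P (x + y) + d * N (x + y)          ≡⟨ weight (x + y) ⟩
    s * (x + y)                        ≡⟨ *-distribˡ-+ s x y ⟩
    s * x + s * y                      ≡⟨ cong₂ _+_ (weight x) (weight y) ⟨
    (P x + d * N x) + (P y + d * N y)  ≡⟨ regroup (P x) (P y) (N x) (N y) d ⟩
    (P x + P y) + d * (N x + N y)      ≤⟨ +-monoʳ-≤ (P x + P y) (*-monoʳ-≤ d h) ⟩
    (P x + P y) + d * N (x + y)        ∎)
    where
    open ≤-Reasoning
    regroup : ∀ a b e f d → (a + d * e) + (b + d * f) ≡ (a + b) + d * (e + f)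
    regroup = solve-∀

  N-subadd⇒P-superadd : ∀ x y w e → N (x + (y + w)) ≤ N x + (N y + e) →
    P x + (P y + s * w) ≤ P (x + (y + w)) + d * e
  N-subadd⇒P-superadd x y w e h = +-cancelʳ-≤ (d * (N x + N y)) _ _ (begin
    P x + (P y + s * w) + d * (N x + N y)      ≡⟨ regroup₁ (P x) (P y) (N x) (N y) d (s * w) ⟩
    (P x + d * N x) + (P y + d * N y) + s * w  ≡⟨ cong₂ (λ a b → a + b + s * w) (weight x) (weight y) ⟩
    s * x + s * y + s * w                      ≡⟨ regroup₂ s x y w ⟩
    s * X                                      ≡⟨ weight X ⟨
    P X + d * N X                              ≤⟨ +-monoʳ-≤ (P X) (*-monoʳ-≤ d h) ⟩
    P X + d * (N x + (N y + e))                ≡⟨ regroup₃ (P X) d (N x) (N y) e ⟩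
    P X + d * e + d * (N x + N y)              ∎)
    where
    open ≤-Reasoning
    X = x + (y + w)
    regroup₁ : ∀ a b e f d g → a + (b + g) + d * (e + f) ≡ (a + d * e) + (b + d * f) + g
    regroup₁ = solve-∀
    regroup₂ : ∀ s x y w → s * x + s * y + s * w ≡ s * (x + (y + w))
    regroup₂ = solve-∀
    regroup₃ : ∀ a d b c e → a + d * (b + (c + e)) ≡ a + d * e + d * (b + c)
    regroup₃ = solve-∀

-- The fixed point of φ

module FixedPoint (p q : ℕ) (1≤q : 1 ≤ q) (q<p : q < p) where

  run : Letter → ℕ
  run A = p
  run B = q

  q≤p : q ≤ p
  q≤p = <⇒≤ q<p

  1≤run : ∀ l → 1 ≤ run l
  1≤run A = ≤-trans 1≤q q≤p
  1≤run B = 1≤q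

  run≤p : ∀ l → run l ≤ p
  run≤p A = ≤-refl
  run≤p B = q≤p

  length-φ : ∀ l → length (φ p q l) ≡ suc (run l)
  length-φ A = length-Aⁿ-B p
  length-φ B = length-Aⁿ-B q

  at-φ-< : ∀ l {t} → t < run l → at (φ p q l) t ≡ A
  at-φ-< A = at-Aⁿ-B-< p
  at-φ-< B = at-Aⁿ-B-< q

  at-φ-run : ∀ l → at (φ p q l) (run l) ≡ B
  at-φ-run A = at-Aⁿ-B-n p
  at-φ-run B = at-Aⁿ-B-n q

  iter-⊑-suc : ∀ k → iter p q k ⊑ iter p q (suc k)
  iter-⊑-suc zero    = A-⊑-Aⁿ-B p (1≤run A)
  iter-⊑-suc (suc k) = concatMap-⊑ (φ p q) (iter-⊑-suc k)

  iter-⊑ : ∀ {k K} → k ≤′ K → iter p q k ⊑ iter p q K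
  iter-⊑ ≤′-refl         = ⊑-refl _
  iter-⊑ (≤′-step {K} h) = ⊑-trans (iter-⊑ h) (iter-⊑-suc K)

  double≤length-φ* : ∀ w → length w + length w ≤ length (φ* p q w)
  double≤length-φ* []      = z≤n
  double≤length-φ* (l ∷ w) = begin
    suc (length w + suc (length w))       ≡⟨ cong suc (+-suc (length w) (length w)) ⟩
    2 + (length w + length w)             ≤⟨ +-mono-≤ (s≤s (1≤run l)) (double≤length-φ* w) ⟩
    suc (run l) + length (φ* p q w)       ≡⟨ cong (_+ length (φ* p q w)) (length-φ l) ⟨
    length (φ p q l) + length (φ* p q w)  ≡⟨ length-++ (φ p q l) ⟨
    length (φ* p q (l ∷ w))               ∎
    where open ≤-Reasoning

  length-iter : ∀ k → k < length (iter p q k)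
  length-iter zero    = s≤s z≤n
  length-iter (suc k) = begin
    suc (suc k)                ≤⟨ +-monoˡ-≤ (suc k) (s≤s z≤n) ⟩
    suc k + suc k              ≤⟨ +-mono-≤ (length-iter k) (length-iter k) ⟩
    length W + length W        ≤⟨ double≤length-φ* W ⟩
    length (iter p q (suc k))  ∎
    where
    open ≤-Reasoning
    W = iter p q k

  u-at-⊑ : ∀ {w K n} → w ⊑ iter p q K → n < length w → u p q n ≡ at w n
  u-at-⊑ {w} {K} {n} w⊑ n<w =
    trans (sym (at-⊑ (iter-⊑ (≤⇒≤′ (m≤n⊔m K (suc n)))) (<-trans (n<1+n n) (length-iter (suc n)))))
          (at-⊑ (⊑-trans w⊑ (iter-⊑ (≤⇒≤′ (m≤m⊔n K (suc n))))) n<w)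

  prefix-⊑-iter : ∀ k → prefix (u p q) (suc k) ⊑ iter p q k
  prefix-⊑-iter k =
    prefix-⊑ (u p q) (iter p q k) (λ i< → sym (u-at-⊑ {K = k} (⊑-refl _) i<)) (suc k) (length-iter k)

  blockStart : ℕ → ℕ
  blockStart k = length (φ* p q (prefix (u p q) k))

  φ*-prefix-suc : ∀ k → φ* p q (prefix (u p q) (suc k)) ≡ φ* p q (prefix (u p q) k) ++ φ p q (u p q k)
  φ*-prefix-suc k = trans (concatMap-++ (φ p q) (prefix (u p q) k) _)
                          (cong (φ* p q (prefix (u p q) k) ++_) (++-identityʳ _))

  blockStart-suc : ∀ k → blockStart (suc k) ≡ blockStart k + suc (run (u p q k))
  blockStart-suc k = trans (cong length (φ*-prefix-suc k))
    (trans (length-++ (φ* p q (prefix (u p q) k))) (cong (blockStart k +_) (length-φ (u p q k))))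

  u-blockwise-φ : ∀ k {t} → t < suc (run (u p q k)) → u p q (blockStart k + t) ≡ at (φ p q (u p q k)) t
  u-blockwise-φ k {t} t< = trans (u-at-⊑ {K = suc k} image⊑ bound) (at-++ʳ (φ* p q (prefix (u p q) k)) (φ p q (u p q k)) t)
    where
    V = φ* p q (prefix (u p q) k) ++ φ p q (u p q k)
    image⊑ : V ⊑ iter p q (suc k)
    image⊑ = subst (_⊑ iter p q (suc k)) (φ*-prefix-suc k) (concatMap-⊑ (φ p q) (prefix-⊑-iter k))
    bound : blockStart k + t < length V
    bound = subst (blockStart k + t <_) (sym (length-++ (φ* p q (prefix (u p q) k))))
              (+-monoʳ-< (blockStart k) (subst (t <_) (sym (length-φ (u p q k))) t<))

  u-in-block : ∀ k {t} → t < run (u p q k) → u p q (blockStart k + t) ≡ A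
  u-in-block k t< = trans (u-blockwise-φ k (m<n⇒m<1+n t<)) (at-φ-< (u p q k) t<)

  u-block-end : ∀ k → u p q (blockStart k + run (u p q k)) ≡ B
  u-block-end k = trans (u-blockwise-φ k ≤-refl) (at-φ-run (u p q k))

  u0≡A : u p q 0 ≡ A
  u0≡A = u-in-block 0 (1≤run (u p q 0))

  N : ℕ → ℕ
  N = #B (u p q)

  N-in-block : ∀ k {t} → t ≤ run (u p q k) → N (blockStart k + t) ≡ N (blockStart k)
  N-in-block k {zero}  _  = cong N (+-identityʳ (blockStart k))
  N-in-block k {suc t} t< = begin
    N (blockStart k + suc t)                               ≡⟨ cong N (+-suc (blockStart k) t) ⟩
    N (blockStart k + t) + isB (u p q (blockStart k + t))  ≡⟨ cong (λ l → N (blockStart k + t) + isB l) (u-in-block k t<) ⟩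
    N (blockStart k + t) + 0                               ≡⟨ +-identityʳ _ ⟩
    N (blockStart k + t)                                   ≡⟨ N-in-block k (<⇒≤ t<) ⟩
    N (blockStart k)                                       ∎
    where open ≡-Reasoning

  N-blockStart : ∀ k → N (blockStart k) ≡ k
  N-blockStart zero    = refl
  N-blockStart (suc k) = begin
    N (blockStart (suc k))                                         ≡⟨ cong N (trans (blockStart-suc k) (+-suc (blockStart k) (run l))) ⟩
    N (blockStart k + run l) + isB (u p q (blockStart k + run l))  ≡⟨ cong₂ (λ n l′ → n + isB l′) (trans (N-in-block k ≤-refl) (N-blockStart k)) (u-block-end k) ⟩
    k + 1                                                          ≡⟨ +-comm k 1 ⟩
    suc k                                                          ∎
    where
    open ≡-Reasoning
    l = u p q k

  N[1+n]<1+n : ∀ r → N (suc r) < suc r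
  N[1+n]<1+n r = s≤s (begin
    N (1 + r)  ≤⟨ #B-+-≤ (u p q) 1 r ⟩
    N 1 + r    ≡⟨ cong (λ l → isB l + r) u0≡A ⟩
    r          ∎)
    where open ≤-Reasoning

  blockStart≤⇒≤N : ∀ {k n} → blockStart k ≤ n → k ≤ N n
  blockStart≤⇒≤N {k} {n} h = subst (_≤ N n) (N-blockStart k) (#B-mono (u p q) h)

  <blockStart⇒N< : ∀ {k n} → n < blockStart k → N n < k
  <blockStart⇒N< {zero}      ()
  <blockStart⇒N< {suc k} {n} n< with n <? blockStart k
  ... | yes n<k = m<n⇒m<1+n (<blockStart⇒N< n<k)
  ... | no  n≮k = s≤s (≤-reflexive (begin
    N n                                    ≡⟨ cong N (m+[n∸m]≡n blockStart≤n) ⟨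
    N (blockStart k + (n ∸ blockStart k))  ≡⟨ N-in-block k offset≤ ⟩
    N (blockStart k)                       ≡⟨ N-blockStart k ⟩
    k                                      ∎))
    where
    open ≡-Reasoning
    blockStart≤n = ≮⇒≥ n≮k
    offset≤ : n ∸ blockStart k ≤ run (u p q k)
    offset≤ = ≤-pred (+-cancelˡ-< (blockStart k) _ _
                (subst₂ _<_ (sym (m+[n∸m]≡n blockStart≤n)) (blockStart-suc k) n<))

  ≤N⇒blockStart≤ : ∀ {k n} → k ≤ N n → blockStart k ≤ n
  ≤N⇒blockStart≤ {k} {n} h with n <? blockStart k
  ... | yes n<blockStart = ⊥-elim (<⇒≱ (<blockStart⇒N< n<blockStart) h)
  ... | no  n≮blockStart = ≮⇒≥ n≮blockStart

  blockStart-N≤ : ∀ n → blockStart (N n) ≤ n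
  blockStart-N≤ n = ≤N⇒blockStart≤ ≤-refl

  <blockStart-suc-N : ∀ n → n < blockStart (suc (N n))
  <blockStart-suc-N n with blockStart (suc (N n)) ≤? n
  ... | yes h = ⊥-elim (1+n≰n (blockStart≤⇒≤N h))
  ... | no  h = ≰⇒> h

  ≤blockStart-N+p : ∀ n → n ≤ blockStart (N n) + p
  ≤blockStart-N+p n = ≤-pred (begin
    suc n                           ≤⟨ <blockStart-suc-N n ⟩
    blockStart (suc (N n))          ≡⟨ blockStart-suc (N n) ⟩
    blockStart (N n) + suc (run _)  ≤⟨ +-monoʳ-≤ (blockStart (N n)) (s≤s (run≤p _)) ⟩
    blockStart (N n) + suc p        ≡⟨ +-suc (blockStart (N n)) p ⟩
    suc (blockStart (N n) + p)      ∎)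
    where open ≤-Reasoning

  d : ℕ
  d = p ∸ q

  block-weight : ∀ l → suc (run l) + d * isB l ≡ suc p
  block-weight A = trans (cong (suc p +_) (*-zeroʳ d)) (+-identityʳ _)
  block-weight B = trans (cong (suc q +_) (*-identityʳ d)) (cong suc (trans (+-comm q d) (m∸n+n≡m q≤p)))

  blockStart+d*N : ∀ k → blockStart k + d * N k ≡ suc p * k
  blockStart+d*N zero    = trans (*-zeroʳ d) (sym (*-zeroʳ (suc p)))
  blockStart+d*N (suc k) = begin
    blockStart (suc k) + d * N (suc k)                    ≡⟨ cong (_+ d * N (suc k)) (blockStart-suc k) ⟩
    blockStart k + suc (run l) + d * (N k + isB l)        ≡⟨ regroup (blockStart k) (suc (run l)) d (N k) (isB l) ⟩
    (blockStart k + d * N k) + (suc (run l) + d * isB l)  ≡⟨ cong₂ _+_ (blockStart+d*N k) (block-weight l) ⟩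
    suc p * k + suc p                                     ≡⟨ +-comm (suc p * k) (suc p) ⟩
    suc p + suc p * k                                     ≡⟨ *-suc (suc p) k ⟨
    suc p * suc k                                         ∎
    where
    open ≡-Reasoning
    l = u p q k
    regroup : ∀ a b d e f → a + b + d * (e + f) ≡ (a + d * e) + (b + d * f)
    regroup = solve-∀

  open WeightedCount blockStart N d (suc p) blockStart+d*N

  N-superadditive : ∀ m j → N j + N m ≤ N (j + m)
  N-superadditive = <-rec _ superadditive
    where
    superadditive : ∀ m → (∀ {m′} → m′ < m → ∀ j → N j + N m′ ≤ N (j + m′)) →
      ∀ j → N j + N m ≤ N (j + m)
    superadditive zero       _  j = ≤-reflexive (trans (+-identityʳ (N j)) (cong N (sym (+-identityʳ j))))
    superadditive m@(suc m′) ih j = blockStart≤⇒≤N (begin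
      blockStart (N j + N m)               ≤⟨ N-superadd⇒P-subadd (N j) (N m) (ih (N[1+n]<1+n m′) (N j)) ⟩
      blockStart (N j) + blockStart (N m)  ≤⟨ +-mono-≤ (blockStart-N≤ j) (blockStart-N≤ m) ⟩
      j + m                                ∎)
      where open ≤-Reasoning

  c : ℕ
  c = ceilDiv p q

  window-slack : ∀ {y w} → c ⊔ y ≤ w → p + y + d * (c ⊔ w) ≤ suc p * w
  window-slack {y} {w} h = begin
    p + y + d * (c ⊔ w)  ≡⟨ cong (λ z → p + y + d * z) (m≤n⇒m⊔n≡n c≤w) ⟩
    p + y + d * w        ≤⟨ +-monoˡ-≤ (d * w) (+-mono-≤ (≤-trans (≤-*-ceilDiv p q 1≤q) (*-monoʳ-≤ q c≤w)) y≤w) ⟩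
    q * w + w + d * w    ≡⟨ regroup q w d ⟩
    (1 + (d + q)) * w    ≡⟨ cong (λ z → suc z * w) (m∸n+n≡m q≤p) ⟩
    suc p * w            ∎
    where
    open ≤-Reasoning
    c≤w = ≤-trans (m≤m⊔n c y) h
    y≤w = ≤-trans (m≤n⊔m c y) h
    regroup : ∀ q w d → q * w + w + d * w ≡ (1 + (d + q)) * w
    regroup = solve-∀

  window-excess : ∀ {x ρ w e} j r y → j < blockStart x → r ≤ blockStart ρ + p →
    blockStart (x + (ρ + w)) ≤ j + (r + y) → N (x + (ρ + w)) ≤ N x + (N ρ + e) →
    suc p * w < p + y + d * e
  window-excess {x} {ρ} {w} {e} j r y j< r≤ blockStartX≤ NX≤ = +-cancelˡ-≤ (blockStart x + blockStart ρ) _ _ (begin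
    blockStart x + blockStart ρ + suc (suc p * w)    ≡⟨ trans (+-suc _ _) (cong suc (+-assoc (blockStart x) (blockStart ρ) _)) ⟩
    suc (blockStart x + (blockStart ρ + suc p * w))  ≤⟨ s≤s (N-subadd⇒P-superadd x ρ w e NX≤) ⟩
    suc (blockStart (x + (ρ + w)) + d * e)           ≤⟨ s≤s (+-monoˡ-≤ (d * e) blockStartX≤) ⟩
    suc (j + (r + y)) + d * e                        ≤⟨ +-monoˡ-≤ (d * e) (+-mono-≤ j< (+-monoˡ-≤ y r≤)) ⟩
    blockStart x + (blockStart ρ + p + y) + d * e    ≡⟨ regroup (blockStart x) (blockStart ρ) p y (d * e) ⟩
    blockStart x + blockStart ρ + (p + y + d * e)    ∎)
    where
    open ≤-Reasoning
    regroup : ∀ a b p y e → a + (b + p + y) + e ≡ a + b + (p + y + e)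
    regroup = solve-∀

  -- The window length y must be generalised: the recursive call is on a
  -- window whose length is the excess w of the current one.
  N-window : ∀ r j y → N (j + (r + y)) ≤ N j + (N r + (c ⊔ y))
  N-window = <-rec _ window
    where
    window : ∀ r → (∀ {r′} → r′ < r → ∀ j y → N (j + (r′ + y)) ≤ N j + (N r′ + (c ⊔ y))) →
      ∀ j y → N (j + (r + y)) ≤ N j + (N r + (c ⊔ y))
    window zero _ j y = ≤-trans (#B-+-≤ (u p q) j y) (+-monoʳ-≤ (N j) (m≤n⊔m c y))
    window r@(suc r′) ih j y with suc (N j) + N r ≤? N (j + (r + y))
    ... | no short = ≤-trans (≤-pred (≰⇒> short)) (+-monoʳ-≤ (N j) (m≤m+n (N r) (c ⊔ y)))
    ... | yes long = begin
      N (j + (r + y))        ≡⟨ S≡ ⟨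
      suc (N j) + (N r + w)  ≡⟨ trans (sym (+-suc (N j) (N r + w))) (cong (N j +_) (sym (+-suc (N r) w))) ⟩
      N j + (N r + suc w)    ≤⟨ +-monoʳ-≤ (N j) (+-monoʳ-≤ (N r) w<) ⟩
      N j + (N r + (c ⊔ y))  ∎
      where
      open ≤-Reasoning
      w = N (j + (r + y)) ∸ (suc (N j) + N r)
      S≡ : suc (N j) + (N r + w) ≡ N (j + (r + y))
      S≡ = trans (sym (+-assoc (suc (N j)) (N r) w)) (m+[n∸m]≡n long)
      excess : suc p * w < p + y + d * (c ⊔ w)
      excess = window-excess {suc (N j)} {N r} {w} {c ⊔ w} j r y (<blockStart-suc-N j) (≤blockStart-N+p r)
                 (≤N⇒blockStart≤ (≤-reflexive S≡)) (ih (N[1+n]<1+n r′) (suc (N j)) w)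
      w< : w < c ⊔ y
      w< with c ⊔ y ≤? w
      ... | yes slack = ⊥-elim (<⇒≱ excess (window-slack slack))
      ... | no  tight = ≰⇒> tight

mainTheorem7 : (p q : ℕ) → 1 ≤ q → q < p →
    Balanced (ceilDiv p q) (u p q)
    × (∀ (j m : ℕ) → countA (u p q) j m ≤ countA (u p q) 0 m)
mainTheorem7 p q 1≤q q<p = balanced-if (u p q) c prefixMaximal subadditive , prefixMaximal
  where
  open FixedPoint p q 1≤q q<p
  prefixMaximal : ∀ j m → countA (u p q) j m ≤ countA (u p q) 0 m
  prefixMaximal = prefixes-maximise-A (u p q) (λ j m → N-superadditive m j)
  subadditive : ∀ j m → N (j + m) ≤ N j + (N m + c)
  subadditive j m = subst₂ _≤_ (cong (λ k → N (j + k)) (+-identityʳ m))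
                      (cong (λ k → N j + (N m + k)) (⊔-identityʳ c)) (N-window m j 0)
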